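{- Let $(N,t)$ be a labelled arboreal network on $X$. Then $d_{(N,t)}(x,y)\neq\odot$ for all $\{x,y\}\in\binom X2$ if and only if $N$ is a phylogenetic tree on $X$.
   Context: $X$ is finite with $|X|\ge2$, $M$ a non-empty set, $\odot\notin M$. In a digraph, a leaf is a vertex of indegree 1 and outdegree 0, a root is a vertex of indegree 0. A network on $X$ is a simple acyclic digraph $N$ whose underlying undirected graph is connected, whose set of leaves is $X$, in which every vertex of indegree 0 has outdegree at least 2, every vertex of outdegree 0 has indegree 1, and no vertex has both indegree and outdegree equal to 1. $N$ is arboreal if its underlying undirected graph is a tree. A phylogenetic tree on $X$ is a network on $X$ with exactly one root in which every vertex has indegree 0 or 1. A least common ancestor of leaves $x,y$ is a vertex with directed paths (possibly of length 0) to both none of whose children has this property; in arboreal networks it is unique when it exists, denoted $\mathrm{lca}_N(x,y)$. A labelled arboreal network $(N,t)$: $N$ arboreal on $X$, $t$ a map from the vertices of outdegree $\ge2$ to $M$; $d_{(N,t)}(x,y)=t(\mathrm{lca}_N(x,y))$ if $x,y$ have a common ancestor, $\odot$ otherwise. -}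

module Defs where

open import Data.Nat using (ℕ; _≤_)
open import Data.Bool using (Bool; true; false; if_then_else_)
open import Data.Fin using (Fin)
open import Data.List using (List; []; _∷_; _++_; [_]; length; map; allFin)
open import Data.Nat.ListAction using (sum)
open import Data.List.Relation.Unary.Linked using (Linked)
open import Data.List.Relation.Unary.Unique.Propositional using (Unique)
open import Data.Product using (Σ; ∃; _×_; _,_)
open import Data.Sum using (_⊎_)
open import Data.Maybe using (Maybe; just; nothing)
open import Relation.Binary.PropositionalEquality using (_≡_; _≢_)
open import Relation.Nullary using (¬_)

-- A finite simple digraph on vertex set Fin n, given by its adjacency
-- (E u v ≡ true  iff  there is an arc u → v). Parallel arcs cannot occur;
-- loops are excluded in the definition of a network.
Digraph : ℕ → Set
Digraph n = Fin n → Fin n → Bool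

module _ {n : ℕ} (E : Digraph n) where

  Arc : Fin n → Fin n → Set
  Arc u v = E u v ≡ true

  indeg : Fin n → ℕ
  indeg v = sum (map (λ u → if E u v then 1 else 0) (allFin n))

  outdeg : Fin n → ℕ
  outdeg v = sum (map (λ w → if E v w then 1 else 0) (allFin n))

  IsLeaf : Fin n → Set
  IsLeaf v = indeg v ≡ 1 × outdeg v ≡ 0

  IsRoot : Fin n → Set
  IsRoot v = indeg v ≡ 0

  data Reach : Fin n → Fin n → Set where
    here  : ∀ {u} → Reach u u
    there : ∀ {u v w} → Arc u v → Reach v w → Reach u w

  Acyclic : Set
  Acyclic = ∀ u v → Arc u v → ¬ Reach v u

  UAdj : Fin n → Fin n → Set
  UAdj u v = Arc u v ⊎ Arc v u

  data UReach : Fin n → Fin n → Set where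
    here  : ∀ {u} → UReach u u
    there : ∀ {u v w} → UAdj u v → UReach v w → UReach u w

  UConnected : Set
  UConnected = ∀ u v → UReach u v

  UCycle : Set
  UCycle = Σ (Fin n) λ a → Σ (List (Fin n)) λ rest →
             2 ≤ length rest × Unique (a ∷ rest) × Linked UAdj (a ∷ rest ++ [ a ])

  UTree : Set
  UTree = UConnected × ¬ UCycle

record Network (k : ℕ) : Set where
  field
    n        : ℕ
    E        : Digraph n
    ι        : Fin k → Fin n
    ι-inj    : ∀ x y → ι x ≡ ι y → x ≡ y
    loopless : ∀ v → E v v ≡ false
    acyclic  : Acyclic E
    connected : UConnected E
    leaves-X : ∀ v → IsLeaf E v → Σ (Fin k) λ x → ι x ≡ v
    X-leaves : ∀ x → IsLeaf E (ι x)
    root-out : ∀ v → indeg E v ≡ 0 → 2 ≤ outdeg E v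
    sink-in  : ∀ v → outdeg E v ≡ 0 → indeg E v ≡ 1
    no-deg2  : ∀ v → ¬ (indeg E v ≡ 1 × outdeg E v ≡ 1)

open Network public

IsArboreal : ∀ {k} → Network k → Set
IsArboreal N = UTree (E N)

IsPhyloTree : ∀ {k} → Network k → Set
IsPhyloTree N =
  (Σ (Fin (n N)) λ r → IsRoot (E N) r × (∀ v → IsRoot (E N) v → v ≡ r))
  × (∀ v → indeg (E N) v ≡ 0 ⊎ indeg (E N) v ≡ 1)

Labelling : ∀ {k} → Network k → Set → Set
Labelling N M = (v : Fin (n N)) → 2 ≤ outdeg (E N) v → M

module _ {k : ℕ} (N : Network k) where

  CommonAnc : Fin (n N) → Fin (n N) → Fin (n N) → Set
  CommonAnc w u v = Reach (E N) w u × Reach (E N) w v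

  IsLCA : Fin (n N) → Fin (n N) → Fin (n N) → Set
  IsLCA w u v = CommonAnc w u v × (∀ c → Arc (E N) w c → ¬ CommonAnc c u v)

  -- d_{(N,t)}(x,y) as a relation with values in Maybe M, where nothing = ⊙ ∉ M.
  -- (lca is unique in an arboreal network, so this is the graph of the function.)
  data D {M : Set} (t : Labelling N M) (x y : Fin k) : Maybe M → Set where
    lca  : ∀ w (p : 2 ≤ outdeg (E N) w) → IsLCA w (ι N x) (ι N y) →
           D t x y (just (t w p))
    none : (¬ Σ (Fin (n N)) λ w → CommonAnc w (ι N x) (ι N y)) →
           D t x y nothing

-- In a phylogenetic tree the root lies above every leaf. In an arboreal
-- network the child leading towards a given descendant is unique, so
-- descending from a common ancestor while both leaves stay below one child
-- ends in a least common ancestor; it is not a leaf, and a tree has no vertex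
-- of outdegree 1, so it carries a label.
-- Conversely, if a vertex v had two parents p₁ ≠ p₂, each pᵢ would reach a
-- leaf yᵢ by an undirected walk avoiding v (go down through a child not
-- leading to v, or up if there is none: a vertex with one child is not a
-- root). Then v is not above yᵢ, so a common ancestor of y₁ and y₂ closes a
-- cycle through v in the underlying tree. Hence every vertex has at most one
-- parent, which makes N a phylogenetic tree.
module Submission where

open import Defs
open import Data.Bool using (Bool; true; false; if_then_else_)
open import Data.Bool.Properties using () renaming (_≟_ to _≟ᴮ_)
open import Data.Fin using (Fin; zero; suc; fromℕ<)
open import Data.Fin.Induction using (spo-wellFounded)
open import Data.Fin.Properties using (_≟_; any?; suc-injective)
open import Data.List using (List; []; _∷_; _++_; map; allFin; tabulate)
open import Data.List.Membership.Propositional using (_∈_)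
open import Data.List.Properties using (map-tabulate)
open import Data.List.Relation.Unary.All using (All; []; _∷_) renaming (map to All-map)
open import Data.List.Relation.Unary.All.Properties using (¬Any⇒All¬)
open import Data.List.Relation.Unary.AllPairs using ([]; _∷_)
open import Data.List.Relation.Unary.Any using (here; there)
open import Data.List.Relation.Unary.Linked using (Linked; [-]; _∷_)
open import Data.List.Relation.Unary.Unique.Propositional using (Unique)
open import Data.Maybe using (just)
open import Data.Nat using (ℕ; zero; suc; _+_; _≤_; z≤n; s≤s)
open import Data.Nat.ListAction using (sum)
open import Data.Nat.Properties using (≤∧≢⇒<; <⇒≱; ≤-reflexive; n≤1⇒n≡0∨n≡1) renaming (_≟_ to _≟ℕ_)
open import Data.Product using (Σ; ∃; _×_; _,_; proj₁; proj₂)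
open import Data.Sum using (_⊎_; inj₁; inj₂; swap)
open import Function using (_∘_; id; flip)
open import Induction.WellFounded using (WellFounded; Acc; acc)
open import Relation.Binary.Core using (Rel)
open import Relation.Binary.Construct.Closure.Transitive using (TransClosure; [_]; _∷_; transitive; wellFounded⁻)
open import Relation.Binary.PropositionalEquality using (_≡_; _≢_; refl; sym; trans; cong; subst; resp₂)
open import Relation.Binary.PropositionalEquality.Properties using (isEquivalence)
open import Relation.Nullary using (¬_; yes; no; contradiction)
open import Relation.Nullary.Decidable using (_×-dec_; ¬?)

count : ∀ {n} → (Fin n → Bool) → ℕ
count {zero}  f = 0
count {suc n} f = (if f zero then 1 else 0) + count (f ∘ suc)

sum-indicator≡count : ∀ {n} (f : Fin n → Bool) →
                      sum (map (λ u → if f u then 1 else 0) (allFin n)) ≡ count f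
sum-indicator≡count f = trans (cong sum (map-tabulate id (λ u → if f u then 1 else 0))) (sum-tabulate f)
  where
  sum-tabulate : ∀ {n} (f : Fin n → Bool) →
                 sum (tabulate (λ u → if f u then 1 else 0)) ≡ count f
  sum-tabulate {zero}  f = refl
  sum-tabulate {suc n} f = cong ((if f zero then 1 else 0) +_) (sum-tabulate (f ∘ suc))

true⇒1≤count : ∀ {n} (f : Fin n → Bool) {u} → f u ≡ true → 1 ≤ count f
true⇒1≤count {suc n} f {u} fu with f zero in f0
true⇒1≤count {suc n} f         fu | true  = s≤s z≤n
true⇒1≤count {suc n} f {zero}  fu | false = contradiction (trans (sym f0) fu) λ ()
true⇒1≤count {suc n} f {suc u} fu | false = true⇒1≤count (f ∘ suc) fu

two-true⇒2≤count : ∀ {n} (f : Fin n → Bool) {u w} →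
                   f u ≡ true → f w ≡ true → u ≢ w → 2 ≤ count f
two-true⇒2≤count {suc n} f {zero}  {zero}  fu fw u≢w = contradiction refl u≢w
two-true⇒2≤count {suc n} f {zero}  {suc w} fu fw u≢w rewrite fu = s≤s (true⇒1≤count (f ∘ suc) fw)
two-true⇒2≤count {suc n} f {suc u} {zero}  fu fw u≢w rewrite fw = s≤s (true⇒1≤count (f ∘ suc) fu)
two-true⇒2≤count {suc n} f {suc u} {suc w} fu fw u≢w with f zero
... | true  = s≤s (true⇒1≤count (f ∘ suc) fu)
... | false = two-true⇒2≤count (f ∘ suc) fu fw (u≢w ∘ cong suc)

count≢0⇒true : ∀ {n} (f : Fin n → Bool) → count f ≢ 0 → ∃ λ u → f u ≡ true
count≢0⇒true {zero}  f c≢0 = contradiction refl c≢0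
count≢0⇒true {suc n} f c≢0 with f zero in f0
... | true  = zero , f0
... | false = let u , fu = count≢0⇒true (f ∘ suc) c≢0 in suc u , fu

false⇒count≡0 : ∀ {n} (f : Fin n → Bool) → (∀ u → f u ≡ false) → count f ≡ 0
false⇒count≡0 {zero}  f all-false = refl
false⇒count≡0 {suc n} f all-false rewrite all-false zero = false⇒count≡0 (f ∘ suc) (all-false ∘ suc)

unique-true⇒count≤1 : ∀ {n} (f : Fin n → Bool) →
                      (∀ {u w} → f u ≡ true → f w ≡ true → u ≡ w) → count f ≤ 1
unique-true⇒count≤1 {zero}  f unique = z≤n
unique-true⇒count≤1 {suc n} f unique with f zero in f0
... | true  = s≤s (≤-reflexive (false⇒count≡0 (f ∘ suc) rest-false))
  where
  rest-false : ∀ u → f (suc u) ≡ false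
  rest-false u with f (suc u) in fu
  ... | false = refl
  ... | true  = contradiction (unique f0 fu) λ ()
... | false = unique-true⇒count≤1 (f ∘ suc) λ fu fw → suc-injective (unique fu fw)

wellFounded-if-⁺-irreflexive : ∀ {n ℓ} {R : Rel (Fin n) ℓ} →
                               (∀ {x} → ¬ TransClosure R x x) → WellFounded R
wellFounded-if-⁺-irreflexive {R = R} irreflexive = wellFounded⁻ R (spo-wellFounded {_≈_ = _≡_} record
  { isEquivalence = isEquivalence
  ; irrefl        = λ { refl → irreflexive }
  ; trans         = transitive R
  ; <-resp-≈      = resp₂ _
  })

module DigraphProperties {n : ℕ} (E : Digraph n) where

  open import Data.List.Membership.DecPropositional (_≟_ {n}) using (_∈?_)

  private
    variable
      a b c p u v w z : Fin n

  Reach-trans : Reach E u v → Reach E v w → Reach E u w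
  Reach-trans here         q = q
  Reach-trans (there e p) q = there e (Reach-trans p q)

  Reach-snoc : Reach E u v → Arc E v w → Reach E u w
  Reach-snoc p e = Reach-trans p (there e here)

  Reach-lastArc : Reach E u w → u ≡ w ⊎ ∃ λ v → Reach E u v × Arc E v w
  Reach-lastArc here = inj₁ refl
  Reach-lastArc (there e p) with Reach-lastArc p
  ... | inj₁ refl          = inj₂ (_ , here , e)
  ... | inj₂ (v , q , e′) = inj₂ (v , there e q , e′)

  indeg≡count : ∀ v → indeg E v ≡ count (λ u → E u v)
  indeg≡count v = sum-indicator≡count (λ u → E u v)

  outdeg≡count : ∀ u → outdeg E u ≡ count (E u)
  outdeg≡count u = sum-indicator≡count (E u)

  Arc⇒1≤indeg : Arc E u v → 1 ≤ indeg E v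
  Arc⇒1≤indeg {v = v} e = subst (1 ≤_) (sym (indeg≡count v)) (true⇒1≤count (λ u → E u v) e)

  Arc⇒1≤outdeg : Arc E u v → 1 ≤ outdeg E u
  Arc⇒1≤outdeg {u} e = subst (1 ≤_) (sym (outdeg≡count u)) (true⇒1≤count (E u) e)

  indeg≡0⇒¬Arc : indeg E v ≡ 0 → ¬ Arc E u v
  indeg≡0⇒¬Arc indeg≡0 e = contradiction (subst (1 ≤_) indeg≡0 (Arc⇒1≤indeg e)) λ ()

  outdeg≡0⇒¬Arc : outdeg E u ≡ 0 → ¬ Arc E u v
  outdeg≡0⇒¬Arc outdeg≡0 e = contradiction (subst (1 ≤_) outdeg≡0 (Arc⇒1≤outdeg e)) λ ()

  indeg≢0⇒parent : indeg E v ≢ 0 → ∃ λ u → Arc E u v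
  indeg≢0⇒parent {v} indeg≢0 = count≢0⇒true (λ u → E u v) (indeg≢0 ∘ trans (indeg≡count v))

  outdeg≢0⇒child : outdeg E u ≢ 0 → ∃ λ v → Arc E u v
  outdeg≢0⇒child {u} outdeg≢0 = count≢0⇒true (E u) (outdeg≢0 ∘ trans (outdeg≡count u))

  two-parents⇒2≤indeg : Arc E a v → Arc E b v → a ≢ b → 2 ≤ indeg E v
  two-parents⇒2≤indeg {v = v} ea eb a≢b =
    subst (2 ≤_) (sym (indeg≡count v)) (two-true⇒2≤count (λ u → E u v) ea eb a≢b)

  unique-child⇒outdeg≤1 : (∀ {v w} → Arc E u v → Arc E u w → v ≡ w) → outdeg E u ≤ 1
  unique-child⇒outdeg≤1 {u} unique =
    subst (_≤ 1) (sym (outdeg≡count u)) (unique-true⇒count≤1 (E u) unique)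

  AtMostOneParent : Set
  AtMostOneParent = ∀ {a b v} → Arc E a v → Arc E b v → a ≡ b

  AtMostOneParent⇒indeg≤1 : AtMostOneParent → ∀ v → indeg E v ≤ 1
  AtMostOneParent⇒indeg≤1 one v =
    subst (_≤ 1) (sym (indeg≡count v)) (unique-true⇒count≤1 (λ u → E u v) one)

  module _ (acyclic : Acyclic E) where

    Arc⁺⇒Reach : TransClosure (Arc E) u v → Reach E u v
    Arc⁺⇒Reach [ e ]   = there e here
    Arc⁺⇒Reach (e ∷ p) = there e (Arc⁺⇒Reach p)

    flip-Arc⁺⇒Reach : TransClosure (flip (Arc E)) u v → Reach E v u
    flip-Arc⁺⇒Reach [ e ]   = there e here
    flip-Arc⁺⇒Reach (e ∷ p) = Reach-snoc (flip-Arc⁺⇒Reach p) e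

    parents-wellFounded : WellFounded (Arc E)
    parents-wellFounded = wellFounded-if-⁺-irreflexive λ
      { [ e ]   → acyclic _ _ e here
      ; (e ∷ p) → acyclic _ _ e (Arc⁺⇒Reach p) }

    children-wellFounded : WellFounded (flip (Arc E))
    children-wellFounded = wellFounded-if-⁺-irreflexive λ
      { [ e ]   → acyclic _ _ e here
      ; (e ∷ p) → acyclic _ _ e (flip-Arc⁺⇒Reach p) }

    root-above : ∀ v → ∃ λ r → IsRoot E r × Reach E r v
    root-above v = go v (parents-wellFounded v)
      where
      go : ∀ v → Acc (Arc E) v → ∃ λ r → IsRoot E r × Reach E r v
      go v (acc rs) with indeg E v ≟ℕ 0
      ... | yes v-root = v , v-root , here
      ... | no  v-inner =
        let u , u→v = indeg≢0⇒parent v-inner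
            r , r-root , r⇝u = go u (rs u→v)
        in r , r-root , Reach-snoc r⇝u u→v

  -- A backward step along w → u stays below r because, u having only one
  -- parent, w lies on the path r ⇝ u.
  root-reaches-all : AtMostOneParent → UConnected E → ∀ {r} → IsRoot E r → ∀ v → Reach E r v
  root-reaches-all one connected {r} r-root v = go (connected r v) here
    where
    go : UReach E u w → Reach E r u → Reach E r w
    go here                   r⇝u = r⇝u
    go (there (inj₁ e) walk) r⇝u = go walk (Reach-snoc r⇝u e)
    go (there (inj₂ e) walk) r⇝u with Reach-lastArc r⇝u
    ... | inj₁ refl            = contradiction e (indeg≡0⇒¬Arc r-root)
    ... | inj₂ (_ , r⇝q , q→u) with one q→u e
    ... | refl = go walk r⇝q

  data AvoidingWalk (v : Fin n) : Fin n → Fin n → Set where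
    stay : a ≢ v → AvoidingWalk v a a
    step : a ≢ v → UAdj E a b → AvoidingWalk v b c → AvoidingWalk v a c

  AvoidingWalk-start : AvoidingWalk v a b → a ≢ v
  AvoidingWalk-start (stay a≢v)     = a≢v
  AvoidingWalk-start (step a≢v _ _) = a≢v

  AvoidingWalk-end : AvoidingWalk v a b → b ≢ v
  AvoidingWalk-end (stay b≢v)   = b≢v
  AvoidingWalk-end (step _ _ w) = AvoidingWalk-end w

  _++ʷ_ : AvoidingWalk v a b → AvoidingWalk v b c → AvoidingWalk v a c
  stay _         ++ʷ w′ = w′
  step a≢v adj w ++ʷ w′ = step a≢v adj (w ++ʷ w′)

  reverseʷ : AvoidingWalk v a b → AvoidingWalk v b a
  reverseʷ (stay a≢v)       = stay a≢v
  reverseʷ (step a≢v adj w) = reverseʷ w ++ʷ step (AvoidingWalk-start w) (swap adj) (stay a≢v)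

  avoid-nonAncestor : ¬ Reach E v z → Reach E w z → AvoidingWalk v w z
  avoid-nonAncestor v↛z here         = stay λ { refl → v↛z here }
  avoid-nonAncestor v↛z (there e p) = step (λ { refl → v↛z (there e p) }) (inj₁ e) (avoid-nonAncestor v↛z p)

  avoid-nonDescendant : ¬ Reach E w v → Reach E w z → AvoidingWalk v w z
  avoid-nonDescendant w↛v here         = stay λ { refl → w↛v here }
  avoid-nonDescendant w↛v (there e p) =
    step (λ { refl → w↛v here }) (inj₁ e) (avoid-nonDescendant (w↛v ∘ there e) p)

  PathVia : Fin n → List (Fin n) → Fin n → Set
  PathVia a []       b = a ≡ b
  PathVia a (c ∷ cs) b = UAdj E a c × PathVia c cs b

  record AvoidingPath (v a b : Fin n) : Set where
    field
      inner  : List (Fin n)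
      unique : Unique (a ∷ inner)
      path   : PathVia a inner b
      avoids : All (_≢ v) (a ∷ inner)

  open AvoidingPath

  AvoidingPath-suffix : ∀ cs → c ∈ (a ∷ cs) → Unique (a ∷ cs) → PathVia a cs b →
                        All (_≢ v) (a ∷ cs) → AvoidingPath v c b
  AvoidingPath-suffix cs (here refl) uniq p av = record { inner = cs ; unique = uniq ; path = p ; avoids = av }
  AvoidingPath-suffix (_ ∷ cs) (there c∈cs) (_ ∷ uniq) (_ , p) (_ ∷ av) = AvoidingPath-suffix cs c∈cs uniq p av

  shortcut : AvoidingWalk v a b → AvoidingPath v a b
  shortcut (stay a≢v) = record { inner = [] ; unique = [] ∷ [] ; path = refl ; avoids = a≢v ∷ [] }
  shortcut {a = a} (step {b = a₁} a≢v adj w) with shortcut w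
  ... | P with a ∈? (a₁ ∷ inner P)
  ... | yes a∈P = AvoidingPath-suffix (inner P) a∈P (unique P) (path P) (avoids P)
  ... | no  a∉P = record
    { inner  = a₁ ∷ inner P
    ; unique = ¬Any⇒All¬ _ a∉P ∷ unique P
    ; path   = adj , path P
    ; avoids = a≢v ∷ avoids P
    }

  PathVia⇒Linked : ∀ cs → PathVia a cs b → UAdj E b v → Linked (UAdj E) (a ∷ cs ++ v ∷ [])
  PathVia⇒Linked []       refl    e = e ∷ [-]
  PathVia⇒Linked (_ ∷ cs) (e′ , p) e = e′ ∷ PathVia⇒Linked cs p e

  neighbours-separated : ¬ UCycle E → a ≢ b → UAdj E v a → UAdj E v b → ¬ AvoidingWalk v a b
  neighbours-separated no-cycle a≢b va vb walk with shortcut walk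
  ... | record { inner = [] ; path = refl } = a≢b refl
  ... | record { inner = c ∷ cs ; unique = uniq ; path = p ; avoids = av } =
    no-cycle (_ , _ ∷ c ∷ cs , s≤s (s≤s z≤n) , All-map (_∘ sym) av ∷ uniq ,
              va ∷ PathVia⇒Linked (c ∷ cs) p (swap vb))

  module Forest (acyclic : Acyclic E) (no-cycle : ¬ UCycle E) where

    child-toward-unique : Arc E u a → Reach E a z → Arc E u b → Reach E b z → a ≡ b
    child-toward-unique {u} {a} {b = b} u→a a⇝z u→b b⇝z with a ≟ b
    ... | yes a≡b = a≡b
    ... | no  a≢b = contradiction
      (avoid-nonDescendant (acyclic u a u→a) a⇝z ++ʷ reverseʷ (avoid-nonDescendant (acyclic u b u→b) b⇝z))
      (neighbours-separated no-cycle a≢b (inj₁ u→a) (inj₁ u→b))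

    parent-side⇒¬descendant : Arc E p v → AvoidingWalk v p z → ¬ Reach E v z
    parent-side⇒¬descendant p→v walk here = AvoidingWalk-end walk refl
    parent-side⇒¬descendant {p} {v} p→v walk (there {v = c} v→c c⇝z) =
      neighbours-separated no-cycle p≢c (inj₂ p→v) (inj₁ v→c)
        (walk ++ʷ reverseʷ (avoid-nonDescendant (acyclic v c v→c) c⇝z))
      where
      p≢c : p ≢ c
      p≢c refl = acyclic p v p→v (there v→c here)

module NetworkProperties {k : ℕ} (N : Network k) where

  open DigraphProperties (E N)

  private
    variable
      a b p u v w z : Fin (n N)
      x y : Fin k

  leaf-no-descendants : Reach (E N) (ι N x) z → z ≡ ι N x
  leaf-no-descendants here = refl
  leaf-no-descendants {x} (there e _) = contradiction e (outdeg≡0⇒¬Arc (proj₂ (X-leaves N x)))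

  leaf-below : ∀ u → ∃ λ x → Reach (E N) u (ι N x)
  leaf-below u = go u (children-wellFounded (acyclic N) u)
    where
    go : ∀ u → Acc (flip (Arc (E N))) u → ∃ λ x → Reach (E N) u (ι N x)
    go u (acc rs) with outdeg (E N) u ≟ℕ 0
    ... | yes u-sink with leaves-X N u (sink-in N u u-sink , u-sink)
    ...   | x , refl = x , here
    go u (acc rs) | no u-inner =
      let c , u→c = outdeg≢0⇒child u-inner
          x , c⇝x = go c (rs u→c)
      in x , there u→c c⇝x

  AtMostOneParent⇒phylo : AtMostOneParent → Fin (n N) → IsPhyloTree N
  AtMostOneParent⇒phylo one v₀ =
    let r , r-root , _ = root-above (acyclic N) v₀
    in (r , r-root , root-unique r-root) , λ v → n≤1⇒n≡0∨n≡1 (AtMostOneParent⇒indeg≤1 one v)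
    where
    root-unique : ∀ {r} → IsRoot (E N) r → ∀ v → IsRoot (E N) v → v ≡ r
    root-unique r-root v v-root with Reach-lastArc (root-reaches-all one (connected N) r-root v)
    ... | inj₁ r≡v            = sym r≡v
    ... | inj₂ (_ , _ , u→v) = contradiction u→v (indeg≡0⇒¬Arc v-root)

  phylo⇒AtMostOneParent : IsPhyloTree N → AtMostOneParent
  phylo⇒AtMostOneParent (_ , indeg-0-or-1) {a} {b} {v} a→v b→v with a ≟ b
  ... | yes a≡b = a≡b
  ... | no  a≢b = contradiction (≤1 (indeg-0-or-1 v)) (<⇒≱ (two-parents⇒2≤indeg a→v b→v a≢b))
    where
    ≤1 : ∀ {m} → m ≡ 0 ⊎ m ≡ 1 → m ≤ 1
    ≤1 (inj₁ refl) = z≤n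
    ≤1 (inj₂ refl) = s≤s z≤n

  phylo⇒2≤outdeg : IsPhyloTree N → Arc (E N) u v → 2 ≤ outdeg (E N) u
  phylo⇒2≤outdeg {u} (_ , indeg-0-or-1) u→v = ≤∧≢⇒< (Arc⇒1≤outdeg u→v) 1≢outdeg
    where
    1≢outdeg : 1 ≢ outdeg (E N) u
    1≢outdeg 1≡outdeg with indeg-0-or-1 u
    ... | inj₁ u-root = <⇒≱ (root-out N u u-root) (≤-reflexive (sym 1≡outdeg))
    ... | inj₂ indeg≡1 = no-deg2 N u (indeg≡1 , sym 1≡outdeg)

  module Arboreal (arboreal : IsArboreal N) where

    open Forest (acyclic N) (proj₂ arboreal)

    lca-exists : Reach (E N) w a → Reach (E N) w b → ∃ λ l → IsLCA N l a b
    lca-exists {w} here w⇝b = w , (here , w⇝b) , λ c w→c c-common → acyclic N w c w→c (proj₁ c-common)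
    lca-exists {w} (there w→a′ a′⇝a) here =
      w , (there w→a′ a′⇝a , here) , λ c w→c c-common → acyclic N w c w→c (proj₂ c-common)
    lca-exists {w} (there {v = a′} w→a′ a′⇝a) (there {v = b′} w→b′ b′⇝b) with a′ ≟ b′
    ... | yes refl = lca-exists a′⇝a b′⇝b
    ... | no  a′≢b′ = w , (there w→a′ a′⇝a , there w→b′ b′⇝b) , λ c w→c (c⇝a , c⇝b) →
      a′≢b′ (trans (child-toward-unique w→a′ a′⇝a w→c c⇝a) (child-toward-unique w→c c⇝b w→b′ b′⇝b))

    phylo⇒branching-lca : IsPhyloTree N → x ≢ y →
                          ∃ λ l → 2 ≤ outdeg (E N) l × IsLCA N l (ι N x) (ι N y)
    phylo⇒branching-lca {x} {y} phylo@((r , r-root , _) , _) x≢y =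
      let reach = root-reaches-all (phylo⇒AtMostOneParent phylo) (connected N) r-root
          l , l-lca = lca-exists (reach (ι N x)) (reach (ι N y))
      in l , branching (proj₁ l-lca) , l-lca
      where
      branching : CommonAnc N w (ι N x) (ι N y) → 2 ≤ outdeg (E N) w
      branching (here , x⇝y)      = contradiction (ι-inj N x y (sym (leaf-no-descendants x⇝y))) x≢y
      branching (there w→c _ , _) = phylo⇒2≤outdeg phylo w→c

    proper-ancestor⇒avoiding-leaf : Acc (Arc (E N)) u → u ≢ v → Reach (E N) u v →
                                    ∃ λ x → AvoidingWalk v u (ι N x)
    proper-ancestor⇒avoiding-leaf _ u≢v here = contradiction refl u≢v
    proper-ancestor⇒avoiding-leaf {u} {v} (acc rs) u≢v (there {v = d} u→d d⇝v)
      with any? (λ c → (E N u c ≟ᴮ true) ×-dec ¬? (c ≟ d))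
    ... | yes (c , u→c , c≢d) =
      let x , c⇝x = leaf-below c
          c↛v     = λ c⇝v → c≢d (child-toward-unique u→c c⇝v u→d d⇝v)
      in x , step u≢v (inj₁ u→c) (avoid-nonDescendant c↛v c⇝x)
    ... | no ∄other-child =
      let q , q→u = indeg≢0⇒parent u-not-root
          x , walk = proper-ancestor⇒avoiding-leaf (rs q→u) (parent≢v q→u) (there q→u (there u→d d⇝v))
      in x , step u≢v (inj₂ q→u) walk
      where
      only-child : ∀ {c} → Arc (E N) u c → c ≡ d
      only-child {c} u→c with c ≟ d
      ... | yes c≡d = c≡d
      ... | no  c≢d = contradiction (c , u→c , c≢d) ∄other-child
      parent≢v : ∀ {q} → Arc (E N) q u → q ≢ v
      parent≢v q→u refl = acyclic N v u q→u (there u→d d⇝v)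
      u-not-root : indeg (E N) u ≢ 0
      u-not-root u-root = <⇒≱ (root-out N u u-root)
                              (unique-child⇒outdeg≤1 λ u→c u→c′ → trans (only-child u→c) (sym (only-child u→c′)))

    parent⇒avoiding-leaf : Arc (E N) p v → ∃ λ x → AvoidingWalk v p (ι N x)
    parent⇒avoiding-leaf {p} p→v = proper-ancestor⇒avoiding-leaf (parents-wellFounded (acyclic N) p)
                                     (λ { refl → acyclic N p p p→v here }) (there p→v here)

    module _ (common : ∀ x y → x ≢ y → ∃ λ w → CommonAnc N w (ι N x) (ι N y)) where

      parents-joined-avoiding : Arc (E N) a v → Arc (E N) b v → AvoidingWalk v a b
      parents-joined-avoiding a→v b→v with parent⇒avoiding-leaf a→v | parent⇒avoiding-leaf b→v
      ... | x , a⇝x | y , b⇝y with x ≟ y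
      ... | yes refl = a⇝x ++ʷ reverseʷ b⇝y
      ... | no  x≢y  =
        let w , w⇝x , w⇝y = common x y x≢y
            v↛x = parent-side⇒¬descendant a→v a⇝x
            v↛y = parent-side⇒¬descendant b→v b⇝y
        in a⇝x ++ʷ (reverseʷ (avoid-nonAncestor v↛x w⇝x) ++ʷ (avoid-nonAncestor v↛y w⇝y ++ʷ reverseʷ b⇝y))

      common-ancestors⇒AtMostOneParent : AtMostOneParent
      common-ancestors⇒AtMostOneParent {a} {b} a→v b→v with a ≟ b
      ... | yes a≡b = a≡b
      ... | no  a≢b = contradiction (parents-joined-avoiding a→v b→v)
                        (neighbours-separated (proj₂ arboreal) a≢b (inj₂ a→v) (inj₂ b→v))

lemma7p2 : {k : ℕ} → 2 ≤ k → (M : Set) → M →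
           (N : Network k) → IsArboreal N → (t : Labelling N M) →
           ((∀ (x y : Fin k) → x ≢ y → Σ M λ m → D N t x y (just m))
             → IsPhyloTree N)
           × (IsPhyloTree N →
             ∀ (x y : Fin k) → x ≢ y → Σ M λ m → D N t x y (just m))
lemma7p2 2≤k M _ N arboreal t = defined⇒phylo , phylo⇒defined
  where
  open NetworkProperties N
  open Arboreal arboreal

  defined⇒phylo : (∀ x y → x ≢ y → Σ M λ m → D N t x y (just m)) → IsPhyloTree N
  defined⇒phylo defined = AtMostOneParent⇒phylo (common-ancestors⇒AtMostOneParent common) (ι N (fromℕ< 2≤k))
    where
    common : ∀ x y → x ≢ y → ∃ λ w → CommonAnc N w (ι N x) (ι N y)
    common x y x≢y with defined x y x≢y
    ... | _ , lca w _ (w-common , _) = w , w-common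

  phylo⇒defined : IsPhyloTree N → ∀ x y → x ≢ y → Σ M λ m → D N t x y (just m)
  phylo⇒defined phylo x y x≢y =
    let l , 2≤outdeg , l-lca = phylo⇒branching-lca phylo x≢y
    in t l 2≤outdeg , lca l 2≤outdeg l-lca
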